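{- For any integers $m,n$ with $2\le m\le n$, the complete bipartite graph $K_{m,n}$ is not closed distance magic.
   Context: A graph on $N$ vertices is closed distance magic if there is a bijection $\ell\colon V\to\{1,\dots,N\}$ and a positive integer $k'$ such that the sum of $\ell$ over the closed neighborhood $N[x]$ ($x$ and its neighbors) of every vertex $x$ equals $k'$. -}

module Defs where

open import Data.Nat using (ℕ; suc; _+_; _<ᵇ_)
open import Data.Bool using (Bool; true; false; if_then_else_; _xor_)
open import Data.Fin using (Fin; toℕ)
open import Data.List using (List; map; filterᵇ; allFin)
open import Data.Nat.ListAction using (sum)
open import Data.Product using (Σ; ∃; _×_)
open import Function.Bundles using (_⤖_; Bijection)
open import Relation.Binary.PropositionalEquality using (_≡_)

record Graph (N : ℕ) : Set where
  field
    adj : Fin N → Fin N → Bool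

open Graph public

IsSimple : ∀ {N} → Graph N → Set
IsSimple {N} G = (∀ x y → adj G x y ≡ adj G y x) × (∀ x → adj G x x ≡ false)

closedNbhdSum : ∀ {N} → Graph N → (Fin N → ℕ) → Fin N → ℕ
closedNbhdSum {N} G ℓ x = ℓ x + sum (map ℓ (filterᵇ (adj G x) (allFin N)))

-- A labelling is a bijection ℓ : V → {1,…,N}; we encode it as
-- ℓ x = 1 + toℕ (σ x) for a bijection σ : Fin N → Fin N.
label : ∀ {N} → (Fin N ⤖ Fin N) → Fin N → ℕ
label σ x = suc (toℕ (Bijection.to σ x))

ClosedDistanceMagic : ∀ {N} → Graph N → Set
ClosedDistanceMagic {N} G =
  Σ (Fin N ⤖ Fin N) λ σ → Σ ℕ λ k′ →
    (0 Data.Nat.< k′) × (∀ x → closedNbhdSum G (label σ) x ≡ k′)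

-- The complete bipartite graph K_{m,n} on Fin (m + n): vertices with index < m
-- form one part, the remaining n vertices the other; x ~ y iff they lie in
-- different parts.
side : ∀ {N} → ℕ → Fin N → Bool
side m x = toℕ x <ᵇ m

K : (m n : ℕ) → Graph (m + n)
K m n = record { adj = λ x y → side m x xor side m y }

-- Two vertices with the same open neighbourhood ("twins") have closed
-- neighbourhood sums differing exactly by the difference of their labels, so a
-- closed distance magic labelling would have to give them equal labels.  In
-- K_{m,n} with m ≥ 2 the first two vertices of the m-part are twins.
module Submission where

open import Defs
open import Data.Nat using (ℕ; _+_; _≤_; s≤s; z≤n; suc)
open import Data.Nat.Properties using (+-cancelʳ-≡; suc-injective)
open import Data.Bool using (_xor_)
open import Data.Fin using (Fin; zero; suc)
open import Data.Fin.Properties using (toℕ-injective)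
open import Data.Product using (_,_)
open import Function.Bundles using (_⤖_; Bijection)
open import Relation.Binary.PropositionalEquality
  using (_≡_; _≢_; refl; cong; trans; sym)
open import Relation.Nullary using (¬_)

label-injective : ∀ {N} (σ : Fin N ⤖ Fin N) {x y} → label σ x ≡ label σ y → x ≡ y
label-injective σ eq = Bijection.injective σ (toℕ-injective (suc-injective eq))

closedNbhdSum-twins : ∀ {N} (G : Graph N) (ℓ : Fin N → ℕ) {x y} →
  adj G x ≡ adj G y → closedNbhdSum G ℓ x ≡ closedNbhdSum G ℓ y → ℓ x ≡ ℓ y
closedNbhdSum-twins G ℓ {x} twins eq rewrite twins = +-cancelʳ-≡ _ (ℓ x) _ eq

twins⇒¬ClosedDistanceMagic : ∀ {N} (G : Graph N) {x y} →
  x ≢ y → adj G x ≡ adj G y → ¬ ClosedDistanceMagic G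
twins⇒¬ClosedDistanceMagic G x≢y twins (σ , k′ , _ , magic) =
  x≢y (label-injective σ
        (closedNbhdSum-twins G (label σ) twins (trans (magic _) (sym (magic _)))))

K-sameSide⇒twins : ∀ m n {x y : Fin (m + n)} →
  side m x ≡ side m y → adj (K m n) x ≡ adj (K m n) y
K-sameSide⇒twins m n same = cong (λ s z → s xor side m z) same

mainTheorem8 : (m n : ℕ) → 2 ≤ m → m ≤ n → ¬ ClosedDistanceMagic (K m n)
mainTheorem8 (suc (suc m)) n (s≤s (s≤s z≤n)) _ =
  twins⇒¬ClosedDistanceMagic (K (2 + m) n) {zero} {suc zero} (λ ())
    (K-sameSide⇒twins (2 + m) n {zero} {suc zero} refl)
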